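{- Let $u$ and $v$ be rich words. If there exist a factor $u'$ of $u$ and a factor $v'$ of $v$ such that $\mathrm{lps}(u')=\mathrm{lps}(v')$, $\mathrm{lpp}(u')=\mathrm{lpp}(v')$ and $u'\neq v'$, then there is no rich word having both $u$ and $v$ as factors.
   Context: A palindrome is a word equal to its reversal (the empty word is a palindrome). A finite word $w$ is rich if it has exactly $|w|+1$ distinct palindromic factors (counting the empty word). For a word $x$, $\mathrm{lps}(x)$ denotes its longest palindromic suffix and $\mathrm{lpp}(x)$ its longest palindromic prefix. -}

module Defs where

open import Level using (Level)
open import Data.Nat using (ℕ; suc; _≤_)
open import Data.List using (List; []; _∷_; _++_; reverse; length)
open import Data.List.Relation.Unary.Unique.Propositional using (Unique)
open import Data.List.Membership.Propositional using (_∈_)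
open import Data.Product using (Σ; ∃; ∃-syntax; _×_; _,_)
open import Relation.Binary.PropositionalEquality using (_≡_)

private variable
  a : Level
  A : Set a

Word : Set a → Set a
Word A = List A

Palindrome : Word A → Set _
Palindrome w = reverse w ≡ w

Factor : Word A → Word A → Set _
Factor f w = ∃[ x ] ∃[ y ] (x ++ f ++ y ≡ w)

Prefix : Word A → Word A → Set _
Prefix p w = ∃[ y ] (p ++ y ≡ w)

Suffix : Word A → Word A → Set _
Suffix s w = ∃[ x ] (x ++ s ≡ w)

-- w has exactly |w|+1 distinct palindromic factors (empty word included):
-- the set of palindromic factors is enumerated by a duplicate-free list
-- of length |w|+1.
Rich : Word A → Set _
Rich {A = A} w =
  Σ (List (Word A)) λ L →
    Unique L
    × (∀ p → p ∈ L → Factor p w × Palindrome p)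
    × (∀ p → Factor p w → Palindrome p → p ∈ L)
    × length L ≡ suc (length w)

IsLps : Word A → Word A → Set _
IsLps x p = Suffix p x × Palindrome p
  × (∀ q → Suffix q x → Palindrome q → length q ≤ length p)

IsLpp : Word A → Word A → Set _
IsLpp x p = Prefix p x × Palindrome p
  × (∀ q → Prefix q x → Palindrome q → length q ≤ length p)

-- In a rich word z the longest palindromic prefix (suffix) occurs only once: otherwise the
-- letters of z would not each contribute a new palindrome, and z would have at most |z|
-- palindromic factors.  Take twins X ≠ Y with the same lpp p and lps s inside a shortest rich
-- word z.  Minimality makes X a prefix and Y a suffix of z (or one a factor of the other,
-- which unioccurrence of p and s inside the larger one forbids).  If lpp z is not longer than
-- X it equals p, which then occurs at the start of Y, so Y = z; dually for lps z.  Otherwise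
-- lpp z and lps z are palindromes properly containing X and Y, so reverse X and reverse Y occur
-- in z with its first letter removed, and they are twins there with the roles of p and s
-- exchanged.  The remaining case, z itself a palindrome, is settled by unioccurrence in
-- reverse Y (or reverse X).
module Submission where

open import Defs
open import Data.List using (List; []; _∷_; _++_; reverse; length; map)
open import Data.List.Properties
  using (∷-injective; ∷-injectiveʳ; ++-assoc; ++-identityʳ; ++-conicalˡ; ++-conicalʳ;
         length-++; length-++-≤ˡ; length-++-≤ʳ; length-removeAt′; length-reverse; length-map;
         reverse-++; reverse-involutive; reverse-injective)
open import Data.List.Membership.Propositional using (_∈_; _─_)
open import Data.List.Membership.Propositional.Properties using (∈-map⁺)
open import Data.List.Relation.Binary.Subset.Propositional using (_⊆_)
open import Data.List.Relation.Unary.Any using (here; there; index)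
open import Data.List.Relation.Unary.All as All using ()
open import Data.List.Relation.Unary.AllPairs using (_∷_)
open import Data.List.Relation.Unary.Unique.Propositional using (Unique)
open import Data.Nat using (suc; _+_; _≤_; _<_; s≤s; z≤n; _≤?_; _<?_)
open import Data.Nat.Properties
  using (≤-refl; ≤-trans; ≤-reflexive; ≤-total; <⇒≤; <⇒≱; ≰⇒>; 1+n≰n; m+1+n≰m; m≤n⇒m<n∨m≡n;
         +-comm; +-cancelˡ-<; n≮n; module ≤-Reasoning)
open import Data.Product using (∃; ∃-syntax; _×_; _,_; proj₁; proj₂; map₂)
open import Data.Sum using (inj₁; inj₂)
open import Data.Empty using (⊥; ⊥-elim)
open import Effect.Monad using (RawMonad)
open import Function using (_∘_; case_of_)
open import Relation.Binary.PropositionalEquality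
  using (_≡_; _≢_; refl; sym; trans; cong; subst; subst₂; module ≡-Reasoning)
open import Relation.Nullary using (¬_; yes; no; contradiction)
open import Relation.Nullary.Decidable using (decidable-stable; ¬¬-excluded-middle)
open import Relation.Nullary.Negation using (¬¬-Monad)

module _ {b} {B : Set b} where

  ∈-─ : ∀ {d e} {ys : List B} (e∈ys : e ∈ ys) → d ∈ ys → d ≢ e → d ∈ ys ─ e∈ys
  ∈-─ (here refl) (here refl) d≢e  = contradiction refl d≢e
  ∈-─ (here _)    (there d∈ys) _   = d∈ys
  ∈-─ (there _)   (here refl) _    = here refl
  ∈-─ (there e∈ys) (there d∈ys) d≢e = there (∈-─ e∈ys d∈ys d≢e)

  Unique-⊆⇒length-≤ : ∀ {xs ys : List B} → Unique xs → xs ⊆ ys → length xs ≤ length ys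
  Unique-⊆⇒length-≤ {[]}     _              _     = z≤n
  Unique-⊆⇒length-≤ {x ∷ xs} {ys} (x∉xs ∷ xs!) xs⊆ys =
    subst (suc (length xs) ≤_) (sym (length-removeAt′ ys (index x∈ys)))
      (s≤s (Unique-⊆⇒length-≤ xs! λ e∈xs →
        ∈-─ x∈ys (xs⊆ys (there e∈xs)) λ e≡x → All.lookup x∉xs e∈xs (sym e≡x)))
    where
    x∈ys : x ∈ ys
    x∈ys = xs⊆ys (here refl)

module _ {a} {A : Set a} where

  open RawMonad (¬¬-Monad {a})

  private variable
    c : A
    p q r s t t′ w x y z X Y α β γ δ : Word A
    C : List (Word A)

  Prefix-length : Prefix x w → length x ≤ length w
  Prefix-length {x = x} (_ , refl) = length-++-≤ˡ x

  Suffix-length : Suffix x w → length x ≤ length w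
  Suffix-length {x = x} (u , refl) = length-++-≤ʳ x {u}

  Prefix-trans : Prefix x y → Prefix y z → Prefix x z
  Prefix-trans {x = x} (u , refl) (v , refl) = u ++ v , sym (++-assoc x u v)

  Prefix-≡ : Prefix x y → length y ≤ length x → x ≡ y
  Prefix-≡ {x = x} ([]    , refl) _  = sym (++-identityʳ x)
  Prefix-≡ {x = x} (_ ∷ _ , refl) le = contradiction (subst (_≤ length x) (length-++ x) le) (m+1+n≰m (length x))

  Suffix-≡ : Suffix x y → length y ≤ length x → x ≡ y
  Suffix-≡ ([]    , refl) _            = refl
  Suffix-≡ {x = x} (_ ∷ u , refl) le = contradiction (≤-trans le (length-++-≤ʳ x {u})) 1+n≰n

  shorter-prefix : Prefix x w → Prefix y w → length x ≤ length y → Prefix x y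
  shorter-prefix {x = []}    _ _ _ = _ , refl
  shorter-prefix {x = _ ∷ _} {y = []} _ _ ()
  shorter-prefix {x = c ∷ x} {y = _ ∷ y} (u , refl) (v , e) (s≤s le) with ∷-injective e
  ... | refl , e′ = map₂ (cong (c ∷_)) (shorter-prefix (u , refl) (v , e′) le)

  Prefix⇒Suffix-reverse : Prefix x w → Suffix (reverse x) (reverse w)
  Prefix⇒Suffix-reverse {x = x} (u , refl) = reverse u , sym (reverse-++ x u)

  Suffix⇒Prefix-reverse : Suffix x w → Prefix (reverse x) (reverse w)
  Suffix⇒Prefix-reverse {x = x} (u , refl) = reverse u , sym (reverse-++ u x)

  shorter-suffix : Suffix x w → Suffix y w → length x ≤ length y → Suffix x y
  shorter-suffix {x = x} {y = y} x-suf y-suf le =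
    subst₂ Suffix (reverse-involutive x) (reverse-involutive y)
      (Prefix⇒Suffix-reverse (shorter-prefix (Suffix⇒Prefix-reverse x-suf) (Suffix⇒Prefix-reverse y-suf)
        (subst₂ _≤_ (sym (length-reverse x)) (sym (length-reverse y)) le)))

  Prefix⇒Factor : Prefix x w → Factor x w
  Prefix⇒Factor (u , e) = [] , u , e

  Suffix⇒Factor : Suffix x w → Factor x w
  Suffix⇒Factor {x = x} (u , e) = u , [] , trans (cong (u ++_) (++-identityʳ x)) e

  Factor-trans : Factor x y → Factor y z → Factor x z
  Factor-trans {x = x} (u , v , refl) (u′ , v′ , refl) = u′ ++ u , v ++ v′ , (begin
    (u′ ++ u) ++ x ++ v ++ v′   ≡⟨ ++-assoc u′ u (x ++ v ++ v′) ⟩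
    u′ ++ u ++ x ++ v ++ v′     ≡⟨ cong (λ m → u′ ++ u ++ m) (++-assoc x v v′) ⟨
    u′ ++ u ++ (x ++ v) ++ v′   ≡⟨ cong (u′ ++_) (++-assoc u (x ++ v) v′) ⟨
    u′ ++ (u ++ x ++ v) ++ v′   ∎)
    where open ≡-Reasoning

  Factor-[] : Factor x [] → x ≡ []
  Factor-[] {x = x} (u , v , e) = ++-conicalˡ x v (++-conicalʳ u (x ++ v) e)

  reverse-occurrence : γ ++ x ++ δ ≡ w → reverse δ ++ reverse x ++ reverse γ ≡ reverse w
  reverse-occurrence {γ = γ} {x = x} {δ = δ} refl = begin
    reverse δ ++ reverse x ++ reverse γ     ≡⟨ ++-assoc (reverse δ) (reverse x) (reverse γ) ⟨
    (reverse δ ++ reverse x) ++ reverse γ   ≡⟨ cong (_++ reverse γ) (reverse-++ x δ) ⟨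
    reverse (x ++ δ) ++ reverse γ           ≡⟨ reverse-++ γ (x ++ δ) ⟨
    reverse (γ ++ x ++ δ)                   ∎
    where open ≡-Reasoning

  Factor-reverse : Factor x w → Factor (reverse x) (reverse w)
  Factor-reverse {x = x} (u , v , e) = reverse v , reverse u , reverse-occurrence {γ = u} {x = x} e

  Factor-tail : Suffix q t → Prefix t (c ∷ z) → length q < length t → Factor q z
  Factor-tail ([] , refl) _ |q|<|q| = contradiction |q|<|q| (n≮n _)
  Factor-tail {q = q} (_ ∷ γ , refl) (ρ , e) _ = γ , ρ , trans (sym (++-assoc γ q ρ)) (∷-injectiveʳ e)

  Palindrome-reverse : Palindrome w → Palindrome (reverse w)
  Palindrome-reverse = cong reverse

  palindrome-Prefix⇒Suffix : Palindrome w → Prefix x w → Suffix (reverse x) w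
  palindrome-Prefix⇒Suffix w-pal x-pre = subst (Suffix _) w-pal (Prefix⇒Suffix-reverse x-pre)

  palindrome-Suffix⇒Prefix : Palindrome w → Suffix x w → Prefix (reverse x) w
  palindrome-Suffix⇒Prefix w-pal x-suf = subst (Prefix _) w-pal (Suffix⇒Prefix-reverse x-suf)

  IsLpp⇒IsLps-reverse : IsLpp z t → IsLps (reverse z) t
  IsLpp⇒IsLps-reverse {z = z} (t-pre , t-pal , t-max) =
    subst (λ u → Suffix u (reverse z)) t-pal (Prefix⇒Suffix-reverse t-pre) , t-pal ,
    λ q q-suf q-pal → t-max q (subst₂ Prefix q-pal (reverse-involutive z) (Suffix⇒Prefix-reverse q-suf)) q-pal

  IsLps⇒IsLpp-reverse : IsLps z r → IsLpp (reverse z) r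
  IsLps⇒IsLpp-reverse {z = z} (r-suf , r-pal , r-max) =
    subst (λ u → Prefix u (reverse z)) r-pal (Suffix⇒Prefix-reverse r-suf) , r-pal ,
    λ q q-pre q-pal → r-max q (subst₂ Suffix q-pal (reverse-involutive z) (Prefix⇒Suffix-reverse q-pre)) q-pal

  palindrome-IsLpp : Palindrome z → IsLpp z z
  palindrome-IsLpp {z = z} z-pal = ([] , ++-identityʳ z) , z-pal , λ _ q-pre _ → Prefix-length q-pre

  IsLpp-prefix : IsLpp z t → Prefix x z → length t ≤ length x → IsLpp x t
  IsLpp-prefix (t-pre , t-pal , t-max) x-pre |t|≤|x| =
    shorter-prefix t-pre x-pre |t|≤|x| , t-pal , λ q q-pre q-pal → t-max q (Prefix-trans q-pre x-pre) q-pal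

  IsLpp-unique : IsLpp z t → IsLpp z t′ → t ≡ t′
  IsLpp-unique {t = t} {t′ = t′} (t-pre , t-pal , t-max) (t′-pre , t′-pal , t′-max) =
    Prefix-≡ (shorter-prefix t-pre t′-pre (t′-max t t-pre t-pal)) (t-max t′ t′-pre t′-pal)

  IsLps-∷ : ¬ Palindrome (c ∷ z) → IsLps z s → IsLps (c ∷ z) s
  IsLps-∷ {c = c} {z = z} {s = s} ¬pal ((σ , e) , s-pal , s-max) = (c ∷ σ , cong (c ∷_) e) , s-pal , max
    where
    max : ∀ q → Suffix q (c ∷ z) → Palindrome q → length q ≤ length s
    max q ([]    , refl) q-pal = contradiction q-pal ¬pal
    max q (_ ∷ σ , e)    q-pal = s-max q (σ , ∷-injectiveʳ e) q-pal

  -- Without decidable equality on A the longest palindromic suffix exists only classically.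
  lps-exists : ∀ z → ¬ ¬ ∃ (IsLps z)
  lps-exists []      = pure ([] , ([] , refl) , refl , λ _ q-suf _ → Suffix-length q-suf)
  lps-exists (c ∷ z) = ¬¬-excluded-middle >>= λ where
    (yes pal) → pure (c ∷ z , ([] , refl) , pal , λ _ q-suf _ → Suffix-length q-suf)
    (no ¬pal) → map₂ (IsLps-∷ ¬pal) <$> lps-exists z

  lpp-exists : ∀ z → ¬ ¬ ∃ (IsLpp z)
  lpp-exists z =
    map₂ (subst (λ u → IsLpp u _) (reverse-involutive z) ∘ IsLps⇒IsLpp-reverse) <$> lps-exists (reverse z)

  PalindromeCover : Word A → List (Word A) → Set a
  PalindromeCover w C = ∀ q → Factor q w → Palindrome q → q ∈ C

  -- "w has more than |w| palindromic factors": classically equivalent to richness, since no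
  -- word has more than |w| + 1, but stated so that no decidable equality on A is needed.
  WeaklyRich : Word A → Set a
  WeaklyRich w = ∀ C → PalindromeCover w C → length w < length C

  Rich⇒WeaklyRich : Rich w → WeaklyRich w
  Rich⇒WeaklyRich (L , L! , L-pal , _ , |L|≡1+|w|) C C-cov =
    subst (_≤ length C) |L|≡1+|w| (Unique-⊆⇒length-≤ L! λ {q} q∈L →
      C-cov q (proj₁ (L-pal q q∈L)) (proj₂ (L-pal q q∈L)))

  -- A palindromic prefix of c ∷ z shorter than t = lpp (c ∷ z) reappears reversed at the end of t.
  cover-∷ : PalindromeCover z C → IsLpp (c ∷ z) t → PalindromeCover (c ∷ z) (t ∷ C)
  cover-∷ C-cov _ q (_ ∷ γ , δ , e) q-pal = there (C-cov q (γ , δ , ∷-injectiveʳ e) q-pal)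
  cover-∷ {t = t} C-cov (t-pre , t-pal , t-max) q ([] , δ , e) q-pal with m≤n⇒m<n∨m≡n (t-max q (δ , e) q-pal)
  ... | inj₂ |q|≡|t| =
    here (Prefix-≡ (shorter-prefix (δ , e) t-pre (≤-reflexive |q|≡|t|)) (≤-reflexive (sym |q|≡|t|)))
  ... | inj₁ |q|<|t| = there (C-cov q (Factor-tail q-suf-t t-pre |q|<|t|) q-pal)
    where
    q-suf-t : Suffix q t
    q-suf-t = subst (λ u → Suffix u t) q-pal
      (palindrome-Prefix⇒Suffix t-pal (shorter-prefix (δ , e) t-pre (<⇒≤ |q|<|t|)))

  cover-[] : PalindromeCover [] ([] ∷ [])
  cover-[] _ q-fac _ = here (Factor-[] q-fac)

  cover-++ˡ : ∀ x → PalindromeCover z C →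
              ¬ ¬ (∃[ D ] PalindromeCover (x ++ z) D × length D ≤ length x + length C)
  cover-++ˡ []      C-cov = pure (_ , C-cov , ≤-refl)
  cover-++ˡ {z = z} (c ∷ x) C-cov = do
    (D , D-cov , |D|≤) ← cover-++ˡ x C-cov
    (t , t-lpp) ← lpp-exists (c ∷ x ++ z)
    pure (t ∷ D , cover-∷ D-cov t-lpp , s≤s |D|≤)

  cover-exists : ∀ w → ¬ ¬ (∃[ C ] PalindromeCover w C × length C ≤ suc (length w))
  cover-exists w = adjust <$> cover-++ˡ w cover-[]
    where
    adjust : ∃[ C ] PalindromeCover (w ++ []) C × length C ≤ length w + 1 →
             ∃[ C ] PalindromeCover w C × length C ≤ suc (length w)
    adjust (C , C-cov , |C|≤) =
      C , subst (λ u → PalindromeCover u C) (++-identityʳ w) C-cov ,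
      ≤-trans |C|≤ (≤-reflexive (+-comm (length w) 1))

  cover-reverse : PalindromeCover w C → PalindromeCover (reverse w) (map reverse C)
  cover-reverse {w = w} {C = C} C-cov q q-fac q-pal =
    subst (_∈ map reverse C) (reverse-involutive q) (∈-map⁺ reverse
      (C-cov (reverse q) (subst (Factor (reverse q)) (reverse-involutive w) (Factor-reverse q-fac))
        (Palindrome-reverse q-pal)))

  WeaklyRich-reverse : WeaklyRich z → WeaklyRich (reverse z)
  WeaklyRich-reverse {z = z} wr C C-cov =
    subst₂ _<_ (sym (length-reverse z)) (length-map reverse C)
      (wr (map reverse C) (subst (λ u → PalindromeCover u (map reverse C)) (reverse-involutive z) (cover-reverse C-cov)))

  WeaklyRich-++ˡ : ∀ x → WeaklyRich (x ++ z) → WeaklyRich z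
  WeaklyRich-++ˡ {z = z} x wr C C-cov = decidable-stable (length z <? length C) λ |z|≮|C| →
    cover-++ˡ x C-cov λ (D , D-cov , |D|≤) → |z|≮|C| (+-cancelˡ-< (length x) (length z) (length C) (begin-strict
      length x + length z   ≡⟨ length-++ x ⟨
      length (x ++ z)       <⟨ wr D D-cov ⟩
      length D              ≤⟨ |D|≤ ⟩
      length x + length C   ∎))
    where open ≤-Reasoning

  WeaklyRich-factor : WeaklyRich w → Factor z w → WeaklyRich z
  WeaklyRich-factor {z = z} wr (x , y , refl) =
    subst WeaklyRich (reverse-involutive z) (WeaklyRich-reverse (WeaklyRich-++ˡ (reverse y)
      (subst WeaklyRich (reverse-++ z y) (WeaklyRich-reverse (WeaklyRich-++ˡ x wr)))))

  lpp-unioccurrent : WeaklyRich z → IsLpp z t → γ ++ t ++ δ ≡ z → γ ≡ []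
  lpp-unioccurrent {γ = []} _ _ _ = refl
  lpp-unioccurrent {t = t} {γ = c ∷ γ} {δ = δ} wr t-lpp@(_ , t-pal , _) refl =
    ⊥-elim (cover-exists (γ ++ t ++ δ) λ (C , C-cov , |C|≤) → <⇒≱ (wr C (C-cov′ C-cov)) |C|≤)
    where
    -- t already occurs in γ ++ t ++ δ, so the letter c contributes no new palindrome.
    C-cov′ : PalindromeCover (γ ++ t ++ δ) C → PalindromeCover (c ∷ γ ++ t ++ δ) C
    C-cov′ C-cov q q-fac q-pal with cover-∷ C-cov t-lpp q q-fac q-pal
    ... | here refl = C-cov t (γ , δ , refl) t-pal
    ... | there q∈C = q∈C

  lps-unioccurrent : WeaklyRich z → IsLps z r → γ ++ r ++ δ ≡ z → δ ≡ []
  lps-unioccurrent {z = z} {r = r} {γ = γ} {δ = δ} wr r-lps@(_ , r-pal , _) e =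
    reverse-injective (lpp-unioccurrent {γ = reverse δ} (WeaklyRich-reverse wr) (IsLps⇒IsLpp-reverse r-lps)
      (subst (λ u → reverse δ ++ u ++ reverse γ ≡ reverse z) r-pal (reverse-occurrence {γ = γ} {x = r} e)))

  Borders : Word A → Word A → Word A → Set a
  Borders X p s = IsLpp X p × IsLps X s

  Borders-reverse : Borders X p s → Borders (reverse X) s p
  Borders-reverse (X-lpp , X-lps) = IsLps⇒IsLpp-reverse X-lps , IsLpp⇒IsLps-reverse X-lpp

  sameBorders-factor⇒≡ : WeaklyRich Y → Borders X p s → Borders Y p s → Factor X Y → X ≡ Y
  sameBorders-factor⇒≡ {p = p} {s = s} wr (((X₁ , refl) , _) , ((X₀ , X₀s≡X) , _)) (Y-lpp , Y-lps)
    (α , β , refl)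
    with lpp-unioccurrent {γ = α} wr Y-lpp (cong (α ++_) (sym (++-assoc p X₁ β)))
       | lps-unioccurrent {γ = α ++ X₀} wr Y-lps (begin
           (α ++ X₀) ++ s ++ β     ≡⟨ ++-assoc α X₀ (s ++ β) ⟩
           α ++ X₀ ++ s ++ β       ≡⟨ cong (α ++_) (++-assoc X₀ s β) ⟨
           α ++ (X₀ ++ s) ++ β     ≡⟨ cong (λ u → α ++ u ++ β) X₀s≡X ⟩
           α ++ (p ++ X₁) ++ β     ∎)
    where open ≡-Reasoning
  ... | refl | refl = sym (++-identityʳ (p ++ X₁))

  -- If lpp z is not longer than X, it is lpp X = p; it starts Y, so by unioccurrence Y = z.
  short-lpp⇒≡ : WeaklyRich z → IsLpp z t → length t ≤ length X →
                Prefix X z → Suffix Y z → Borders X p s → Borders Y p s → X ≡ Y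
  short-lpp⇒≡ {z = z} {Y = Y} {p = p} wr t-lpp |t|≤|X| X-pre (α , αY≡z)
    X-bord@(X-lpp , _) Y-bord@(((Y₁ , pY₁≡Y) , _) , _) =
    sameBorders-factor⇒≡ (subst WeaklyRich (sym Y≡z) wr) X-bord Y-bord
      (subst (Factor _) (sym Y≡z) (Prefix⇒Factor X-pre))
    where
    p-lpp : IsLpp z p
    p-lpp = subst (IsLpp z) (IsLpp-unique (IsLpp-prefix t-lpp X-pre |t|≤|X|) X-lpp) t-lpp
    Y≡z : Y ≡ z
    Y≡z with refl ← lpp-unioccurrent {γ = α} wr p-lpp (trans (cong (α ++_) pY₁≡Y) αY≡z) = αY≡z

  short-lps⇒≡ : WeaklyRich z → IsLps z r → length r ≤ length Y →
                Prefix X z → Suffix Y z → Borders X p s → Borders Y p s → X ≡ Y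
  short-lps⇒≡ {r = r} {Y = Y} wr r-lps |r|≤|Y| X-pre Y-suf X-bord Y-bord =
    reverse-injective (sym (short-lpp⇒≡ (WeaklyRich-reverse wr) (IsLps⇒IsLpp-reverse r-lps)
      (subst (length r ≤_) (sym (length-reverse Y)) |r|≤|Y|)
      (Suffix⇒Prefix-reverse Y-suf) (Prefix⇒Suffix-reverse X-pre) (Borders-reverse Y-bord) (Borders-reverse X-bord)))

  -- X is a prefix of reverse Y and ends with s = lpp (reverse Y), so X = s; then X = p starts Y.
  palindrome-shorter⇒≡ : WeaklyRich z → Palindrome z → Prefix X z → Suffix Y z → length X ≤ length Y →
                         Borders X p s → Borders Y p s → X ≡ Y
  palindrome-shorter⇒≡ {z = z} {X = X} {Y = Y} {p = p} {s = s} wr z-pal X-pre Y-suf |X|≤|Y|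
    X-bord@(X-lpp , (X₀ , X₀s≡X) , s-pal , _) Y-bord@(((Y₁ , pY₁≡Y) , _) , Y-lps) =
    sameBorders-factor⇒≡ (WeaklyRich-factor wr (Suffix⇒Factor Y-suf)) X-bord Y-bord
      ([] , Y₁ , trans (cong (_++ Y₁) (sym p≡X)) pY₁≡Y)
    where
    revY-pre : Prefix (reverse Y) z
    revY-pre = palindrome-Suffix⇒Prefix z-pal Y-suf
    X-pre-revY : Prefix X (reverse Y)
    X-pre-revY = shorter-prefix X-pre revY-pre (subst (length X ≤_) (sym (length-reverse Y)) |X|≤|Y|)
    X₀≡[] : X₀ ≡ []
    X₀≡[] = lpp-unioccurrent {γ = X₀} (WeaklyRich-factor wr (Prefix⇒Factor revY-pre)) (IsLps⇒IsLpp-reverse Y-lps)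
      (trans (sym (++-assoc X₀ s (proj₁ X-pre-revY)))
        (trans (cong (_++ proj₁ X-pre-revY) X₀s≡X) (proj₂ X-pre-revY)))
    X-pal : Palindrome X
    X-pal = subst Palindrome (subst (λ u → u ++ s ≡ X) X₀≡[] X₀s≡X) s-pal
    p≡X : p ≡ X
    p≡X = IsLpp-unique X-lpp (palindrome-IsLpp X-pal)

  palindrome-prefix-suffix⇒≡ : WeaklyRich z → Palindrome z → Prefix X z → Suffix Y z →
                               Borders X p s → Borders Y p s → X ≡ Y
  palindrome-prefix-suffix⇒≡ {X = X} {Y = Y} wr z-pal X-pre Y-suf X-bord Y-bord with ≤-total (length X) (length Y)
  ... | inj₁ |X|≤|Y| = palindrome-shorter⇒≡ wr z-pal X-pre Y-suf |X|≤|Y| X-bord Y-bord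
  ... | inj₂ |Y|≤|X| = reverse-injective (sym (palindrome-shorter⇒≡
          (WeaklyRich-reverse wr) (Palindrome-reverse z-pal)
          (Suffix⇒Prefix-reverse Y-suf) (Prefix⇒Suffix-reverse X-pre)
          (subst₂ _≤_ (sym (length-reverse Y)) (sym (length-reverse X)) |Y|≤|X|)
          (Borders-reverse Y-bord) (Borders-reverse X-bord)))

  Twins : Word A → Set a
  Twins z = ∃[ X ] ∃[ Y ] ∃[ p ] ∃[ s ] (Factor X z × Factor Y z × Borders X p s × Borders Y p s × X ≢ Y)

  Twins-factor : Factor z w → Twins z → Twins w
  Twins-factor z-fac (X , Y , p , s , X-fac , Y-fac , rest) =
    X , Y , p , s , Factor-trans X-fac z-fac , Factor-trans Y-fac z-fac , rest

  tail-Factor : Factor z (c ∷ z)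
  tail-Factor {z = z} {c = c} = c ∷ [] , [] , cong (c ∷_) (++-identityʳ z)

  reverse-prefix-in-tail : Palindrome t → Prefix t (c ∷ z) → Prefix X (c ∷ z) → length X < length t →
                           Factor (reverse X) z
  reverse-prefix-in-tail {t = t} {X = X} t-pal t-pre X-pre |X|<|t| =
    Factor-tail (palindrome-Prefix⇒Suffix t-pal (shorter-prefix X-pre t-pre (<⇒≤ |X|<|t|))) t-pre
      (subst (_< length t) (sym (length-reverse X)) |X|<|t|)

  reverse-suffix-in-tail : Palindrome r → Suffix r (c ∷ z) → length r < length (c ∷ z) →
                           Suffix Y (c ∷ z) → length Y ≤ length r → Factor (reverse Y) z
  reverse-suffix-in-tail r-pal r-suf |r|<|cz| Y-suf |Y|≤|r| =
    Factor-trans (Prefix⇒Factor (palindrome-Suffix⇒Prefix r-pal (shorter-suffix Y-suf r-suf |Y|≤|r|)))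
      (Factor-tail r-suf ([] , ++-identityʳ _) |r|<|cz|)

  prefix-suffix-twins : WeaklyRich (c ∷ z) → ¬ Twins z → Prefix X (c ∷ z) → Suffix Y (c ∷ z) →
                        Borders X p s → Borders Y p s → X ≢ Y → ⊥
  prefix-suffix-twins {c = c} {z = z} {X = X} {Y = Y} {p = p} {s = s} wr no-twins X-pre Y-suf X-bord Y-bord X≢Y =
    lpp-exists (c ∷ z) λ (t , t-lpp) → lps-exists (c ∷ z) λ (r , r-lps) → by-lengths t-lpp r-lps
    where
    by-lengths : ∀ {t r} → IsLpp (c ∷ z) t → IsLps (c ∷ z) r → ⊥
    by-lengths {t} {r} t-lpp@(t-pre , t-pal , _) r-lps@(r-suf , r-pal , _)
      with length t ≤? length X | length r ≤? length Y | m≤n⇒m<n∨m≡n (Suffix-length r-suf)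
    ... | yes |t|≤|X| | _ | _ = X≢Y (short-lpp⇒≡ wr t-lpp |t|≤|X| X-pre Y-suf X-bord Y-bord)
    ... | no _ | yes |r|≤|Y| | _ = X≢Y (short-lps⇒≡ wr r-lps |r|≤|Y| X-pre Y-suf X-bord Y-bord)
    ... | no _ | no _ | inj₂ |r|≡|cz| =
      X≢Y (palindrome-prefix-suffix⇒≡ wr (subst Palindrome (Suffix-≡ r-suf (≤-reflexive (sym |r|≡|cz|))) r-pal)
             X-pre Y-suf X-bord Y-bord)
    ... | no |t|≰|X| | no |r|≰|Y| | inj₁ |r|<|cz| =
      no-twins (reverse X , reverse Y , s , p ,
                reverse-prefix-in-tail t-pal t-pre X-pre (≰⇒> |t|≰|X|) ,
                reverse-suffix-in-tail r-pal r-suf |r|<|cz| Y-suf (<⇒≤ (≰⇒> |r|≰|Y|)) ,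
                Borders-reverse X-bord , Borders-reverse Y-bord , X≢Y ∘ reverse-injective)

  prefix-factor-twins : WeaklyRich (c ∷ z) → ¬ Twins z → Prefix X (c ∷ z) → Factor Y (c ∷ z) →
                        Borders X p s → Borders Y p s → X ≢ Y → ⊥
  prefix-factor-twins {c = c} {z = z} {X = X} {Y = Y} wr no-twins X-pre (α , β , αYβ≡cz) X-bord Y-bord X≢Y =
    case ≤-total (length X) (length (α ++ Y)) of λ where
      (inj₁ |X|≤|αY|) → X-inside α (shorter-prefix X-pre αY-pre |X|≤|αY|) αYβ≡cz
      (inj₂ |αY|≤|X|) → X≢Y (sym (Y-inside (shorter-prefix αY-pre X-pre |αY|≤|X|)))
    where
    αY-pre : Prefix (α ++ Y) (c ∷ z)
    αY-pre = β , trans (++-assoc α Y β) αYβ≡cz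

    Y-inside : Prefix (α ++ Y) X → Y ≡ X
    Y-inside (ε , αYε≡X) = sameBorders-factor⇒≡ (WeaklyRich-factor wr (Prefix⇒Factor X-pre)) Y-bord X-bord
      (α , ε , trans (sym (++-assoc α Y ε)) αYε≡X)

    X-inside : ∀ α → Prefix X (α ++ Y) → α ++ Y ++ β ≡ c ∷ z → ⊥
    X-inside [] X-pre-Y Yβ≡cz =
      X≢Y (sameBorders-factor⇒≡ (WeaklyRich-factor wr ([] , β , Yβ≡cz)) X-bord Y-bord (Prefix⇒Factor X-pre-Y))
    X-inside (a ∷ α′) X-pre-aα′Y aα′Yβ≡cz =
      prefix-suffix-twins (WeaklyRich-factor wr (Prefix⇒Factor (β , trans (++-assoc (a ∷ α′) Y β) aα′Yβ≡cz)))
        (no-twins ∘ Twins-factor ([] , β , trans (++-assoc α′ Y β) (∷-injectiveʳ aα′Yβ≡cz)))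
        X-pre-aα′Y (a ∷ α′ , refl) X-bord Y-bord X≢Y

  ¬Twins : WeaklyRich z → ¬ Twins z
  ¬Twins {z = []} _ (_ , _ , _ , _ , X-fac , Y-fac , _ , _ , X≢Y) =
    X≢Y (trans (Factor-[] X-fac) (sym (Factor-[] Y-fac)))
  ¬Twins {z = c ∷ z} wr (X , Y , p , s , (_ ∷ α , β , e) , (_ ∷ α′ , β′ , e′) , X-bord , Y-bord , X≢Y) =
    ¬Twins (WeaklyRich-factor wr tail-Factor)
      (X , Y , p , s , (α , β , ∷-injectiveʳ e) , (α′ , β′ , ∷-injectiveʳ e′) , X-bord , Y-bord , X≢Y)
  ¬Twins {z = c ∷ z} wr (_ , _ , _ , _ , ([] , β , e) , Y-fac , X-bord , Y-bord , X≢Y) =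
    prefix-factor-twins wr (¬Twins (WeaklyRich-factor wr tail-Factor)) (β , e) Y-fac X-bord Y-bord X≢Y
  ¬Twins {z = c ∷ z} wr (_ , _ , _ , _ , X-fac , ([] , β′ , e′) , X-bord , Y-bord , X≢Y) =
    prefix-factor-twins wr (¬Twins (WeaklyRich-factor wr tail-Factor)) (β′ , e′) X-fac Y-bord X-bord (X≢Y ∘ sym)

mainTheorem2 : ∀ {a} {A : Set a} (u v : Word A) → Rich u → Rich v
    → (∃[ u′ ] ∃[ v′ ] ∃[ s ] ∃[ p ]
         (Factor u′ u × Factor v′ v
          × IsLps u′ s × IsLps v′ s
          × IsLpp u′ p × IsLpp v′ p
          × u′ ≢ v′))
    → ¬ (∃[ w ] (Rich w × Factor u w × Factor v w))
mainTheorem2 _ _ _ _ (u′ , v′ , s , p , u′-fac , v′-fac , u′-lps , v′-lps , u′-lpp , v′-lpp , u′≢v′)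
                     (w , w-rich , u-fac , v-fac) =
  ¬Twins (Rich⇒WeaklyRich w-rich)
    (u′ , v′ , p , s , Factor-trans u′-fac u-fac , Factor-trans v′-fac v-fac ,
     (u′-lpp , u′-lps) , (v′-lpp , v′-lps) , u′≢v′)
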